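{- For every domain $D$ there is a DPW $M_D$ over $E\cup A$ equivalent to $\omega_D$ (i.e., $[[M_D]]=\omega_D$), whose size is at most exponential in the size of $D$ and which has two colors.
   Context: A domain is $D=(E,A,I,Pre,\Delta)$ where $E$ (fluents) and $A$ (action variables) are disjoint non-empty finite sets of Boolean variables, $\mathcal{E}=2^E$, $\mathcal{A}=2^A$, $I\subseteq\mathcal{E}$ is non-empty, $Pre\subseteq\mathcal{E}\times\mathcal{A}$ is such that every $s\in\mathcal{E}$ has some $a$ with $(s,a)\in Pre$ ($a$ is available in $s$), and $\Delta\subseteq\mathcal{E}\times\mathcal{A}\times\mathcal{E}$ with $(s,a,t)\in\Delta$ implying $(s,a)\in Pre$. Domains are given compactly by $(E,A,init,pre,\delta)$ with Boolean formulas $init$ over $E$, $pre$ over $E\cup A$, $\delta$ over $E\cup A\cup E'$ ($E'=\{e':e\in E\}$), inducing $s\in I$ iff $s\models init$, $(s,a)\in Pre$ iff $s\cup a\models pre$, $(s,a,t)\in\Delta$ iff $s\cup a\cup\{e':e\in t\}\models\delta$. The size of $D$ is $|E|+|A|+|init|+|pre|+|\delta|$. $\omega_D$ is the set of infinite traces $\pi=\pi_0\pi_1\cdots$ ($\pi_k\subseteq E\cup A$) such that (1) $\pi_0\cap E\in I$ and (2) for all $n\ge1$, if $\pi_i\cap A$ is available in $\pi_i\cap E$ for every $i\in[0,n-1]$, then $(\pi_{n-1}\cap E,\pi_{n-1}\cap A,\pi_n\cap E)\in\Delta$. A DPW over $E\cup A$ is $M=(Q,q_{in},T,col)$ with finite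 state set $Q$, $T:Q\times 2^{E\cup A}\to Q$, $col:Q\to\mathbb{Z}$; it accepts a trace iff the largest color occurring infinitely often on its run is even; size is $|Q|$, number of colors is $|col(Q)|$. -}

module Defs where

open import Data.Nat using (ℕ; zero; suc; _+_; _≤_; _<_)
open import Data.Integer using (ℤ) renaming (_≤_ to _≤ℤ_; _*_ to _*ℤ_; +_ to +ℤ_)
open import Data.Integer.Properties using ()
open import Data.Fin using (Fin)
open import Data.Bool using (Bool; true; false; not; _∧_; _∨_)
open import Data.Sum using (_⊎_; inj₁; inj₂)
open import Data.Product using (Σ; ∃; ∃-syntax; _×_; _,_)
open import Relation.Binary.PropositionalEquality using (_≡_; _≢_)
open import Relation.Nullary using (¬_)
open import Function.Bundles using (_⇔_)

data Formula (V : Set) : Set where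
  var  : V → Formula V
  tt   : Formula V
  ff   : Formula V
  neg  : Formula V → Formula V
  conj : Formula V → Formula V → Formula V
  disj : Formula V → Formula V → Formula V

-- an assignment is the characteristic function of the set of true variables
_⊨_ : {V : Set} → (V → Bool) → Formula V → Bool
σ ⊨ var x      = σ x
σ ⊨ tt         = true
σ ⊨ ff         = false
σ ⊨ neg φ      = not (σ ⊨ φ)
σ ⊨ conj φ ψ   = (σ ⊨ φ) ∧ (σ ⊨ ψ)
σ ⊨ disj φ ψ   = (σ ⊨ φ) ∨ (σ ⊨ ψ)

fsize : {V : Set} → Formula V → ℕ
fsize (var _)    = 1
fsize tt         = 1
fsize ff         = 1
fsize (neg φ)    = suc (fsize φ)
fsize (conj φ ψ) = suc (fsize φ + fsize ψ)
fsize (disj φ ψ) = suc (fsize φ + fsize ψ)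

-- Variables: fluents E = Fin nE, actions A = Fin nA (disjoint by ⊎),
-- primed fluents E' = a second copy of Fin nE.

-- subsets of E (elements of 𝓔 = 2^E) and of A (elements of 𝓐 = 2^A)
StateSet : ℕ → Set
StateSet nE = Fin nE → Bool

ActSet : ℕ → Set
ActSet nA = Fin nA → Bool

Letter : ℕ → ℕ → Set
Letter nE nA = Fin nE ⊎ Fin nA → Bool

_∪ₗ_ : ∀ {nE nA} → StateSet nE → ActSet nA → Letter nE nA
(s ∪ₗ a) (inj₁ e) = s e
(s ∪ₗ a) (inj₂ x) = a x

-- s ∪ a ∪ {e' : e ∈ t}
triple : ∀ {nE nA} → StateSet nE → ActSet nA → StateSet nE →
         (Fin nE ⊎ Fin nA ⊎ Fin nE → Bool)
triple s a t (inj₁ e)        = s e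
triple s a t (inj₂ (inj₁ x)) = a x
triple s a t (inj₂ (inj₂ e)) = t e

∩E : ∀ {nE nA} → Letter nE nA → StateSet nE
∩E l e = l (inj₁ e)

∩A : ∀ {nE nA} → Letter nE nA → ActSet nA
∩A l x = l (inj₂ x)

record Domain : Set where
  field
    nE    : ℕ
    nA    : ℕ
    initF : Formula (Fin nE)
    preF  : Formula (Fin nE ⊎ Fin nA)
    δF    : Formula (Fin nE ⊎ Fin nA ⊎ Fin nE)

  I : StateSet nE → Set
  I s = (s ⊨ initF) ≡ true

  Pre : StateSet nE → ActSet nA → Set
  Pre s a = ((s ∪ₗ a) ⊨ preF) ≡ true

  Δ : StateSet nE → ActSet nA → StateSet nE → Set
  Δ s a t = (triple s a t ⊨ δF) ≡ true

  field
    E-nonempty   : 0 < nE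
    A-nonempty   : 0 < nA
    I-nonempty   : ∃[ s ] I s
    Pre-total    : ∀ s → ∃[ a ] Pre s a
    Δ⊆Pre        : ∀ s a t → Δ s a t → Pre s a

  size : ℕ
  size = nE + nA + fsize initF + fsize preF + fsize δF

  Trace : Set
  Trace = ℕ → Letter nE nA

  -- π ∈ ω_D   (condition (2) written with n = suc m)
  InOmega : Trace → Set
  InOmega π =
    I (∩E (π 0)) ×
    (∀ m → (∀ i → i ≤ m → Pre (∩E (π i)) (∩A (π i))) →
           Δ (∩E (π m)) (∩A (π m)) (∩E (π (suc m))))

record DPW (nE nA : ℕ) : Set where
  field
    nQ  : ℕ
    qin : Fin nQ
    T   : Fin nQ → Letter nE nA → Fin nQ
    col : Fin nQ → ℤ

  run : (ℕ → Letter nE nA) → ℕ → Fin nQ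
  run π zero    = qin
  run π (suc i) = T (run π i) (π i)

  InfOften : (ℕ → Letter nE nA) → ℤ → Set
  InfOften π c = ∀ N → ∃[ i ] (N ≤ i × col (run π i) ≡ c)

  Accepts : (ℕ → Letter nE nA) → Set
  Accepts π = ∃[ c ] (InfOften π c × (∀ c' → InfOften π c' → c' ≤ℤ c)
                       × ∃[ k ] (c ≡ +ℤ 2 *ℤ k))

  size : ℕ
  size = nQ

  TwoColors : Set
  TwoColors = ∃[ c₁ ] ∃[ c₂ ] (c₁ ≢ c₂ ×
                (∃[ q ] col q ≡ c₁) × (∃[ q ] col q ≡ c₂) ×
                (∀ q → col q ≡ c₁ ⊎ col q ≡ c₂))

module Submission where

-- The traces of a domain D form a safety language: a trace leaves ω_D exactly
-- when, at a point where all preconditions so far were met, a letter violates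
-- init (at the start) or δ (with respect to the previous letter).  Such a
-- violation can be detected by a deterministic automaton that remembers only
-- the previous letter, so it has 3 + 2^(|E|+|A|) states: `start`, the
-- accepting sink `unconstrained` (reached once a precondition fails, after
-- which ω_D imposes nothing), the rejecting sink `violated`, and `after c`
-- for every letter code c.  Colouring `violated` with 1 and all other states
-- with 0 gives a two-coloured DPW.

open import Defs
open import Data.Nat using (ℕ; _≤_; _*_; _^_)
open import Data.Product using (Σ; ∃; ∃-syntax; _×_; _,_)
open import Data.Product using (proj₁; proj₂)
open import Function.Bundles using (_⇔_)

open import Data.Nat using (zero; suc; _+_; _<_; _≤′_; ≤′-refl; ≤′-step; z≤n; s≤s; s≤s⁻¹)
open import Data.Nat.Properties
  using (≤-refl; ≤-trans; ≤⇒≤′; +-comm; +-assoc; +-identityʳ; *-identityˡ;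
         +-mono-≤; +-monoʳ-≤; n≤1+n; m≤n⇒m<n∨m≡n; m*n≡1⇒m≡1; m^n>0; ^-monoʳ-≤; module ≤-Reasoning)
open import Data.Integer using (ℤ; +_; ∣_∣) renaming (_≤_ to _≤ℤ_; _*_ to _*ℤ_)
open import Data.Integer.Properties using (abs-*) renaming (≤-reflexive to ≤ℤ-reflexive)
open import Data.Fin using (Fin; funToFin; finToFun; splitAt; join) renaming (zero to fzero; suc to fsuc)
open import Data.Fin.Properties using (finToFun-funToFin; splitAt-join; 2↔Bool)
open import Data.Bool using (Bool; true; false; if_then_else_; not; _∧_; _∨_)
open import Data.Sum using (_⊎_; inj₁; inj₂)
open import Data.Empty using (⊥-elim)
open import Function using (case_of_)
open import Function.Bundles using (mk⇔; Equivalence; Inverse)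
open import Relation.Binary.PropositionalEquality
  using (_≡_; _≢_; refl; sym; trans; cong; cong₂; module ≡-Reasoning)

one-not-even : ∀ k → + 1 ≢ + 2 *ℤ k
one-not-even k eq with m*n≡1⇒m≡1 2 ∣ k ∣ (sym (trans (cong ∣_∣ eq) (abs-* (+ 2) k)))
... | ()

⊨-cong : ∀ {V : Set} {σ τ : V → Bool} → (∀ x → σ x ≡ τ x) → ∀ φ → σ ⊨ φ ≡ τ ⊨ φ
⊨-cong σ≗τ (var x)    = σ≗τ x
⊨-cong σ≗τ tt         = refl
⊨-cong σ≗τ ff         = refl
⊨-cong σ≗τ (neg φ)    = cong not (⊨-cong σ≗τ φ)
⊨-cong σ≗τ (conj φ ψ) = cong₂ _∧_ (⊨-cong σ≗τ φ) (⊨-cong σ≗τ ψ)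
⊨-cong σ≗τ (disj φ ψ) = cong₂ _∨_ (⊨-cong σ≗τ φ) (⊨-cong σ≗τ ψ)

fsize-pos : ∀ {V : Set} (φ : Formula V) → 1 ≤ fsize φ
fsize-pos (var _)    = s≤s z≤n
fsize-pos tt         = s≤s z≤n
fsize-pos ff         = s≤s z≤n
fsize-pos (neg _)    = s≤s z≤n
fsize-pos (conj _ _) = s≤s z≤n
fsize-pos (disj _ _) = s≤s z≤n

-- Adding n to 2^m costs at most n doublings; this bounds the state count.
plus-pow-bound : ∀ n m → n + 2 ^ m ≤ 2 ^ (n + m)
plus-pow-bound zero    m = ≤-refl
plus-pow-bound (suc n) m = begin
    1 + (n + 2 ^ m)          ≤⟨ +-mono-≤ (m^n>0 2 (n + m)) (plus-pow-bound n m) ⟩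
    2 ^ (n + m) + 2 ^ (n + m) ≡⟨ cong (λ y → 2 ^ (n + m) + y) (sym (+-identityʳ (2 ^ (n + m)))) ⟩
    2 ^ (suc n + m)          ∎
  where open ≤-Reasoning

module Safety {nE nA : ℕ} (M : DPW nE nA) where
  open DPW M

  stays-one : (∀ q l → col q ≡ + 1 → col (T q l) ≡ + 1) →
              ∀ π {i j} → col (run π i) ≡ + 1 → i ≤′ j → col (run π j) ≡ + 1
  stays-one absorbing π one ≤′-refl      = one
  stays-one absorbing π one (≤′-step i≤j) = absorbing _ _ (stays-one absorbing π one i≤j)

  safety-accepts : (∀ q → col q ≡ + 0 ⊎ col q ≡ + 1) →
                   (∀ q l → col q ≡ + 1 → col (T q l) ≡ + 1) →
                   ∀ π → Accepts π ⇔ (∀ i → col (run π i) ≡ + 0)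
  safety-accepts two-valued absorbing π = mk⇔ always-zero accepted
    where
    always-zero : Accepts π → ∀ i → col (run π i) ≡ + 0
    always-zero (c , inf , _ , k , c-even) i with two-valued (run π i)
    ... | inj₁ zero-at-i = zero-at-i
    ... | inj₂ one-at-i with inf i
    ...   | j , i≤j , c-at-j =
      ⊥-elim (one-not-even k (trans (sym (stays-one absorbing π one-at-i (≤⇒≤′ i≤j)))
                                    (trans c-at-j c-even)))

    accepted : (∀ i → col (run π i) ≡ + 0) → Accepts π
    accepted zero-always = + 0 , (λ N → N , ≤-refl , zero-always N) , maximal , + 0 , refl
      where
      maximal : ∀ c → InfOften π c → c ≤ℤ + 0
      maximal c inf with inf 0
      ... | j , _ , c-at-j = ≤ℤ-reflexive (trans (sym c-at-j) (zero-always j))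

runFrom : {S L : Set} → S → (S → L → S) → (ℕ → L) → ℕ → S
runFrom start step π zero    = start
runFrom start step π (suc i) = step (runFrom start step π i) (π i)

module Realisation {nE nA n : ℕ} {S : Set}
         (toFin : S → Fin n) (fromFin : Fin n → S) (from-to : ∀ x → fromFin (toFin x) ≡ x)
         (start : S) (step : S → Letter nE nA → S) (colour : S → ℤ) where

  automaton : DPW nE nA
  automaton = record
    { nQ  = n
    ; qin = toFin start
    ; T   = λ q l → toFin (step (fromFin q) l)
    ; col = λ q → colour (fromFin q)
    }

  decode-run : ∀ π i → fromFin (DPW.run automaton π i) ≡ runFrom start step π i
  decode-run π zero    = from-to start
  decode-run π (suc i) = trans (from-to _) (cong (λ x → step x (π i)) (decode-run π i))

data St (C : Set) : Set where
  start         : St C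
  unconstrained : St C       -- a precondition failed: ω_D imposes nothing more
  violated      : St C       -- init or δ was violated (rejecting sink)
  after         : C → St C   -- all preconditions held; c codes the last letter

colour : ∀ {C} → St C → ℤ
colour violated = + 1
colour _        = + 0

colour-zero : ∀ {C} (x : St C) → x ≢ violated → colour x ≡ + 0
colour-zero start         _ = refl
colour-zero unconstrained _ = refl
colour-zero violated      v = ⊥-elim (v refl)
colour-zero (after _)     _ = refl

colour-zero⇒safe : ∀ {C} (x : St C) → colour x ≡ + 0 → x ≢ violated
colour-zero⇒safe violated () refl

colour-one : ∀ {C} (x : St C) → colour x ≡ + 1 → x ≡ violated
colour-one start         ()
colour-one unconstrained ()
colour-one violated      _ = refl
colour-one (after _)     ()

toFin : ∀ {N} → St (Fin N) → Fin (3 + N)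
toFin start         = fzero
toFin unconstrained = fsuc fzero
toFin violated      = fsuc (fsuc fzero)
toFin (after c)     = fsuc (fsuc (fsuc c))

fromFin : ∀ {N} → Fin (3 + N) → St (Fin N)
fromFin fzero                  = start
fromFin (fsuc fzero)           = unconstrained
fromFin (fsuc (fsuc fzero))    = violated
fromFin (fsuc (fsuc (fsuc c))) = after c

from-to : ∀ {N} (x : St (Fin N)) → fromFin (toFin x) ≡ x
from-to start         = refl
from-to unconstrained = refl
from-to violated      = refl
from-to (after _)     = refl

module LetterCode (nE nA : ℕ) where
  open Inverse 2↔Bool renaming (to to bit→bool; from to bool→bit; strictlyInverseˡ to bool-bit)

  encode : Letter nE nA → Fin (2 ^ (nE + nA))
  encode l = funToFin (λ i → bool→bit (l (splitAt nE i)))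

  decode : Fin (2 ^ (nE + nA)) → Letter nE nA
  decode c x = bit→bool (finToFun c (join nE nA x))

  decode-encode : ∀ l x → decode (encode l) x ≡ l x
  decode-encode l x = begin
      bit→bool (finToFun (encode l) (join nE nA x))
        ≡⟨ cong bit→bool (finToFun-funToFin (λ i → bool→bit (l (splitAt nE i))) (join nE nA x)) ⟩
      bit→bool (bool→bit (l (splitAt nE (join nE nA x)))) ≡⟨ bool-bit _ ⟩
      l (splitAt nE (join nE nA x))                        ≡⟨ cong l (splitAt-join nE nA x) ⟩
      l x                                                  ∎
    where open ≡-Reasoning

module DomainAutomaton (D : Domain) where
  open Domain D
  open LetterCode nE nA

  Code : Set
  Code = Fin (2 ^ (nE + nA))

  -- Boolean versions of I, Pre and Δ on letters: `I (∩E l)` is `initial? l ≡ true`,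
  -- `Pre (∩E l) (∩A l)` is `enabled? l ≡ true`, and
  -- `Δ (∩E p) (∩A p) (∩E l)` is `successor? p l ≡ true`.
  initial? : Letter nE nA → Bool
  initial? l = ∩E l ⊨ initF

  enabled? : Letter nE nA → Bool
  enabled? l = (∩E l ∪ₗ ∩A l) ⊨ preF

  successor? : Letter nE nA → Letter nE nA → Bool
  successor? p l = triple (∩E p) (∩A p) (∩E l) ⊨ δF

  -- Only the letter's values matter, so decoding a code loses nothing.
  successor?-decode : ∀ p l → successor? (decode (encode p)) l ≡ successor? p l
  successor?-decode p l = ⊨-cong same δF
    where
    same : ∀ x → triple (∩E (decode (encode p))) (∩A (decode (encode p))) (∩E l) x
               ≡ triple (∩E p) (∩A p) (∩E l) x
    same (inj₁ e)        = decode-encode p (inj₁ e)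
    same (inj₂ (inj₁ a)) = decode-encode p (inj₂ a)
    same (inj₂ (inj₂ e)) = refl

  guard : Bool → St Code → St Code
  guard b x = if b then x else violated

  proceed : Letter nE nA → St Code
  proceed l = if enabled? l then after (encode l) else unconstrained

  step : St Code → Letter nE nA → St Code
  step start         l = guard (initial? l) (proceed l)
  step unconstrained l = unconstrained
  step violated      l = violated
  step (after c)     l = guard (successor? (decode c) l) (proceed l)

  run : (ℕ → Letter nE nA) → ℕ → St Code
  run = runFrom start step

  guard-pass : ∀ {b} x → b ≡ true → guard b x ≡ x
  guard-pass x refl = refl

  guard-open : ∀ b x → guard b x ≢ violated → b ≡ true
  guard-open true  x _   = refl
  guard-open false x blk = ⊥-elim (blk refl)

  proceed-enabled : ∀ l → enabled? l ≡ true → proceed l ≡ after (encode l)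
  proceed-enabled l en rewrite en = refl

  proceed-cases : ∀ l → proceed l ≡ unconstrained ⊎ (proceed l ≡ after (encode l) × enabled? l ≡ true)
  proceed-cases l with enabled? l
  ... | true  = inj₂ (refl , refl)
  ... | false = inj₁ refl

  step-after : ∀ p l → successor? p l ≡ true → step (after (encode p)) l ≡ proceed l
  step-after p l succ = guard-pass (proceed l) (trans (successor?-decode p l) succ)

  successor-of-safe : ∀ π i → run π (suc i) ≡ after (encode (π i)) →
                      run π (suc (suc i)) ≢ violated → successor? (π i) (π (suc i)) ≡ true
  successor-of-safe π i tracking safe =
    trans (sym (successor?-decode (π i) (π (suc i))))
          (guard-open _ (proceed (π (suc i)))
                      (λ v → safe (trans (cong (λ x → step x (π (suc i))) tracking) v)))

  EnabledUpTo : (ℕ → Letter nE nA) → ℕ → Set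
  EnabledUpTo π i = ∀ k → k ≤ i → enabled? (π k) ≡ true

  module Sound (π : ℕ → Letter nE nA) (ω : InOmega π) where
    settle : ∀ i → run π (suc i) ≡ proceed (π i) → (∀ k → k < i → enabled? (π k) ≡ true) →
             run π (suc i) ≡ unconstrained ⊎ (run π (suc i) ≡ after (encode (π i)) × EnabledUpTo π i)
    settle i reached before with proceed-cases (π i)
    ... | inj₁ released        = inj₁ (trans reached released)
    ... | inj₂ (tracked , en) = inj₂ (trans reached tracked , upTo)
      where
      upTo : EnabledUpTo π i
      upTo k k≤i with m≤n⇒m<n∨m≡n k≤i
      ... | inj₁ k<i  = before k k<i
      ... | inj₂ refl = en

    shape : ∀ i → run π (suc i) ≡ unconstrained ⊎ (run π (suc i) ≡ after (encode (π i)) × EnabledUpTo π i)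
    shape zero = settle zero (guard-pass (proceed (π 0)) (proj₁ ω)) (λ _ ())
    shape (suc j) with shape j
    ... | inj₁ released = inj₁ (cong (λ x → step x (π (suc j))) released)
    ... | inj₂ (tracked , en) =
      settle (suc j)
             (trans (cong (λ x → step x (π (suc j))) tracked)
                    (step-after (π j) (π (suc j)) (proj₂ ω j en)))
             (λ k k<1+j → en k (s≤s⁻¹ k<1+j))

    never-violated : ∀ i → run π i ≢ violated
    never-violated zero ()
    never-violated (suc i) v with shape i
    ... | inj₁ released       = case trans (sym released) v of λ ()
    ... | inj₂ (tracked , _) = case trans (sym tracked) v of λ ()

  module Complete (π : ℕ → Letter nE nA) (safe : ∀ i → run π i ≢ violated) where
    initial : initial? (π 0) ≡ true
    initial = guard-open _ (proceed (π 0)) (safe 1)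

    tracks : ∀ m → EnabledUpTo π m → ∀ i → i ≤ m → run π (suc i) ≡ after (encode (π i))
    tracks m en zero    i≤m = trans (guard-pass (proceed (π 0)) initial) (proceed-enabled (π 0) (en 0 z≤n))
    tracks m en (suc j) i≤m = begin
        step (run π (suc j)) (π (suc j))        ≡⟨ cong (λ x → step x (π (suc j))) tracked ⟩
        step (after (encode (π j))) (π (suc j)) ≡⟨ step-after (π j) (π (suc j)) succ ⟩
        proceed (π (suc j))                     ≡⟨ proceed-enabled (π (suc j)) (en (suc j) i≤m) ⟩
        after (encode (π (suc j)))              ∎
      where
      open ≡-Reasoning
      tracked : run π (suc j) ≡ after (encode (π j))
      tracked = tracks m en j (≤-trans (n≤1+n j) i≤m)
      succ : successor? (π j) (π (suc j)) ≡ true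
      succ = successor-of-safe π j tracked (safe (suc (suc j)))

    in-omega : InOmega π
    in-omega = initial , λ m en → successor-of-safe π m (tracks m en m ≤-refl) (safe (suc (suc m)))

  omega-safe : ∀ π → InOmega π ⇔ (∀ i → run π i ≢ violated)
  omega-safe π = mk⇔ (Sound.never-violated π) (Complete.in-omega π)

  open Realisation toFin fromFin from-to start step colour public using (automaton; decode-run)

  two-valued : ∀ q → DPW.col automaton q ≡ + 0 ⊎ DPW.col automaton q ≡ + 1
  two-valued q with fromFin q
  ... | start         = inj₁ refl
  ... | unconstrained = inj₁ refl
  ... | violated      = inj₂ refl
  ... | after _       = inj₁ refl

  absorbing : ∀ q l → DPW.col automaton q ≡ + 1 → DPW.col automaton (DPW.T automaton q l) ≡ + 1
  absorbing q l one rewrite from-to (step (fromFin q) l) | colour-one (fromFin q) one = refl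

  correct : ∀ π → DPW.Accepts automaton π ⇔ InOmega π
  correct π = mk⇔
    (λ acc → Equivalence.from (omega-safe π) (λ i →
       colour-zero⇒safe _ (trans (sym (colour-run i)) (Equivalence.to accepts acc i))))
    (λ ω → Equivalence.from accepts (λ i →
       trans (colour-run i) (colour-zero _ (Equivalence.to (omega-safe π) ω i))))
    where
    accepts : DPW.Accepts automaton π ⇔ (∀ i → DPW.col automaton (DPW.run automaton π i) ≡ + 0)
    accepts = Safety.safety-accepts automaton two-valued absorbing π
    colour-run : ∀ i → DPW.col automaton (DPW.run automaton π i) ≡ colour (run π i)
    colour-run i = cong colour (decode-run π i)

  two-colours : DPW.TwoColors automaton
  two-colours = + 0 , + 1 , (λ ()) , (toFin start , refl) , (toFin violated , refl) , two-valued

  -- 3 + 2^(|E|+|A|) ≤ 2^(3+|E|+|A|) ≤ 2^|D|, each formula contributing one to |D|.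
  size-bound : DPW.size automaton ≤ 2 ^ (1 * size)
  size-bound = begin
      3 + 2 ^ (nE + nA)   ≤⟨ plus-pow-bound 3 (nE + nA) ⟩
      2 ^ (3 + (nE + nA)) ≤⟨ ^-monoʳ-≤ 2 exponent ⟩
      2 ^ (1 * size)      ∎
    where
    open ≤-Reasoning
    x : ℕ
    x = nE + nA
    exponent : 3 + x ≤ 1 * size
    exponent = begin
        3 + x         ≡⟨ +-comm 3 x ⟩
        x + 3         ≡⟨ sym (trans (+-assoc (x + 1) 1 1) (+-assoc x 1 2)) ⟩
        x + 1 + 1 + 1 ≤⟨ +-mono-≤ (+-mono-≤ (+-monoʳ-≤ x (fsize-pos initF)) (fsize-pos preF))
                                  (fsize-pos δF) ⟩
        size          ≡⟨ sym (*-identityˡ size) ⟩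
        1 * size      ∎

lemma4 : ∃[ c ] ∀ (D : Domain) →
           ∃[ M ] (∀ π → DPW.Accepts {Domain.nE D} {Domain.nA D} M π ⇔ Domain.InOmega D π)
                  × DPW.size M ≤ 2 ^ (c * Domain.size D)
                  × DPW.TwoColors M
lemma4 = 1 , λ D → let open DomainAutomaton D in automaton , correct , size-bound , two-colours
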